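{- Let $\alpha\in S_n$ and let $a\in\{1,\dots,n\}$ satisfy $a+1<\alpha(a)$ and be such that $X_1=\{a+1,a+2,\dots,\alpha(a)-1\}$ is a union of cycles of $\alpha$. Let $X_2=\{1,\dots,n\}\setminus X_1$, and let $\alpha_1,\alpha_2$ be the restrictions of $\alpha$ to $X_1$ and $X_2$. Then $g(\alpha)=g(\alpha_1)+g(\alpha_2)$.
   Context: Permutations are composed right to left; $z(\pi)$ is the number of cycles. For a finite set $X\subseteq\mathbb Z$ with $m$ elements, let $\zeta_X$ be the cyclic permutation of $X$ sending each element to the next larger element of $X$ and the largest to the smallest; the genus of a permutation $\pi$ of $X$ is defined by $m+1-2g(\pi)=z(\pi)+z(\pi^{ -1}\zeta_X)$ (for $X=\{1,\dots,n\}$, $\zeta_X=(1,2,\dots,n)$). -}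

module Defs where

open import Data.Nat using (ℕ; zero; suc; _+_; _∸_; _≤_; _<_; _<ᵇ_; _≤ᵇ_; _⊔_; _⊓_)
open import Data.Nat.Properties using (_<?_)
open import Data.Bool using (Bool; true; false; if_then_else_; not)
open import Data.Fin using (Fin; toℕ; fromℕ<)
open import Data.Fin.Permutation using (Permutation′; _⟨$⟩ʳ_; _⟨$⟩ˡ_)
open import Data.List using (List; []; _∷_; length; filter; map; upTo; foldr)
open import Data.Bool.ListAction using (any; all)
open import Data.List.Membership.Propositional using (_∈_)
open import Data.Product using (_×_)
open import Data.Integer using (ℤ; +_; _-_)
open import Data.Rational.Unnormalised using (ℚᵘ; _/_)
open import Relation.Nullary using (yes; no)
open import Relation.Nullary.Decidable using (⌊_⌋)
open import Function using (_∘_)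

iter : (ℕ → ℕ) → ℕ → ℕ → ℕ
iter f zero    x = x
iter f (suc k) x = f (iter f k x)

-- A finite set X ⊆ ℕ is represented by a duplicate-free list of its elements.
-- For a permutation σ of X (|X| = m), x is the minimum of its cycle iff
-- x ≤ σ^k x for all k < m.  The number of cycles z(σ) is the number of
-- elements of X that are minima of their cycle (one per cycle).
isCycleMin : (ℕ → ℕ) → ℕ → ℕ → Bool
isCycleMin σ m x = all (λ k → x ≤ᵇ iter σ k x) (upTo m)

z : List ℕ → (ℕ → ℕ) → ℕ
z X σ = length (filter (λ x → isCycleMin σ (length X) x Data.Bool.≟ true) X)
  where import Data.Bool

minList : ℕ → List ℕ → ℕ
minList d []       = d
minList d (y ∷ ys) = foldr _⊓_ y ys

ζ : List ℕ → ℕ → ℕ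
ζ X x with filter (λ y → x <? y) X
... | []       = minList x X
... | (y ∷ ys) = minList y (y ∷ ys)

-- Genus of a permutation π of X (given together with its inverse πinv):
-- m + 1 - 2 g(π) = z(π) + z(π⁻¹ ζ_X), i.e. g(π) = (m + 1 - z(π) - z(π⁻¹ζ_X)) / 2.
-- Composition is right to left: (π⁻¹ ζ_X)(x) = π⁻¹(ζ_X(x)).
genus : List ℕ → (ℕ → ℕ) → (ℕ → ℕ) → ℚᵘ
genus X π πinv =
  ((+ (length X + 1) - + z X π) - + z X (πinv ∘ ζ X)) / 2

-- Lift a function on Fin n to ℕ acting on {1,…,n} (i ↦ toℕ/ shifted by one),
-- identity outside {1,…,n}.
liftFin : {n : ℕ} → (Fin n → Fin n) → ℕ → ℕ
liftFin f zero = zero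
liftFin {n} f (suc k) with k <? n
... | yes k<n = suc (toℕ (f (fromℕ< k<n)))
... | no  _   = suc k

ap : {n : ℕ} → Permutation′ n → ℕ → ℕ
ap α = liftFin (α ⟨$⟩ʳ_)

apInv : {n : ℕ} → Permutation′ n → ℕ → ℕ
apInv α = liftFin (α ⟨$⟩ˡ_)

range1 : ℕ → List ℕ
range1 n = map suc (upTo n)

openInterval : ℕ → ℕ → List ℕ
openInterval lo hi = map (λ i → lo + 1 + i) (upTo (hi ∸ lo ∸ 1))

_∖_ : List ℕ → List ℕ → List ℕ
X ∖ Y = filter (λ x → not (any (λ y → ⌊ x Data.Nat.≟ y ⌋) Y) Data.Bool.≟ true) X
  where import Data.Bool ; import Data.Nat

-- X is a union of cycles of f (with inverse g): X is closed under f and f⁻¹.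
UnionOfCycles : (ℕ → ℕ) → (ℕ → ℕ) → List ℕ → Set
UnionOfCycles f g X = ∀ x → x ∈ X → (f x ∈ X) × (g x ∈ X)

-- Cycles are counted by their minima.  Since X₁ is a union of cycles of α, the
-- cycles of α are those of α₁ together with those of α₂.  For β = α⁻¹ζ write
-- b = α(a) and c = b - 1.  On X₁ ∖ {c} the map β agrees with β₁ = α₁⁻¹ζ_{X₁},
-- while β(c) = α⁻¹(b) = a lies below X₁; on X₂ ∖ {a} it agrees with
-- β₂ = α₂⁻¹ζ_{X₂}, while β₂ fixes a.  So β fuses the fixed point a of β₂ with the
-- β₁-cycle through c into one cycle, whose minimum is a: z(β) + 1 = z(β₁) + z(β₂).
-- With m = |X₁| + |X₂| and z(α) = z(α₁) + z(α₂), the genera add.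

module Submission where

open import Defs
open import Data.Nat
  using (ℕ; zero; suc; pred; _+_; _*_; _∸_; _⊓_; _≤_; _<_; _≤ᵇ_; z≤n; s≤s; s≤s⁻¹; >-nonZero)
open import Data.Nat.Properties
open import Data.Nat.DivMod using (_%_; _/_; m≡m%n+[m/n]*n; m%n<n)
open import Data.Bool using (Bool; true; false; not; T)
import Data.Bool as Bool
open import Data.Bool.Properties using (⇔→≡; T-≡; ¬-not)
open import Data.Bool.ListAction using (all; any)
open import Data.List using (List; []; _∷_; _++_; length; filter; map; upTo; applyUpTo; lookup)
open import Data.List.Properties
  using (length-++; filter-++; filter-all; filter-none; map-upTo; foldr-preservesᵒ)
open import Data.List.Membership.Propositional using (_∈_; _∉_)
open import Data.List.Membership.Propositional.Properties
  using (∈-upTo⁺; ∈-upTo⁻; ∈-filter⁺; ∈-filter⁻; ∈-map⁺; ∈-map⁻; foldr-selective)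
open import Data.List.Relation.Unary.Any using (Any; here; there; index)
import Data.List.Relation.Unary.Any as Any
open import Data.List.Relation.Unary.Any.Properties using (lookup-index; any⁺; any⁻)
import Data.List.Relation.Unary.All as All
open import Data.List.Relation.Unary.All.Properties using (all⁺; all⁻)
open import Data.List.Relation.Unary.Unique.Propositional using (Unique)
import Data.List.Relation.Unary.Unique.Propositional.Properties as Unique
open import Data.List.Relation.Unary.AllPairs using (_∷_)
open import Data.List.Extrema ≤-totalOrder using (argmin; f[argmin]≤f[xs])
open import Data.Nat.Tactic.RingSolver using (solve-∀)
open import Data.Rational.Unnormalised using (_≃_; *≡*) renaming (_+_ to _+q_)
import Data.Rational.Unnormalised as ℚ
open import Data.Fin using (Fin; toℕ; fromℕ<)
open import Data.Fin.Permutation using (Permutation′; inverseˡ; inverseʳ)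
open import Data.Fin.Properties using (pigeonhole; toℕ<n; fromℕ<-toℕ; toℕ-fromℕ<)
open import Data.Product using (∃; _×_; _,_; proj₁; proj₂)
open import Data.Sum using (_⊎_; inj₁; inj₂)
open import Function using (_∘_; case_of_; _⇔_; mk⇔; Equivalence)
open import Function.Properties.Equivalence using () renaming (trans to ⇔-trans; sym to ⇔-sym)
open import Relation.Nullary using (¬_; Dec; yes; no; contradiction)
open import Relation.Nullary.Decidable using (⌊_⌋; toWitness; fromWitness)
open import Relation.Binary.Definitions using (tri<; tri≈; tri>)
open import Relation.Binary.PropositionalEquality

count : (ℕ → Bool) → List ℕ → ℕ
count p xs = length (filter (λ x → p x Bool.≟ true) xs)

count-++ : ∀ p xs ys → count p (xs ++ ys) ≡ count p xs + count p ys
count-++ p xs ys = trans (cong length (filter-++ _ xs ys)) (length-++ (filter _ xs))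

count-cong : ∀ {p q} xs → (∀ {x} → x ∈ xs → p x ≡ q x) → count p xs ≡ count q xs
count-cong [] _ = refl
count-cong {p} {q} (x ∷ xs) p≡q with p x | q x | p≡q (here refl)
... | true  | .true  | refl = cong suc (count-cong xs (p≡q ∘ there))
... | false | .false | refl = count-cong xs (p≡q ∘ there)

count-except : ∀ {p q xs u} → Unique xs → u ∈ xs → p u ≡ true → q u ≡ false →
  (∀ {x} → x ∈ xs → x ≢ u → p x ≡ q x) → count p xs ≡ suc (count q xs)
count-except {p} {q} {x ∷ xs} (x∉xs ∷ _) (here refl) pu qu p≡q rewrite pu | qu =
  cong suc (count-cong xs (λ y∈xs → p≡q (there y∈xs) (All.lookup x∉xs y∈xs ∘ sym)))
count-except {p} {q} {x ∷ xs} (x∉xs ∷ uniq) (there u∈xs) pu qu p≡q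
  with p x | q x | p≡q (here refl) (All.lookup x∉xs u∈xs)
... | true  | .true  | refl = cong suc (count-except uniq u∈xs pu qu (p≡q ∘ there))
... | false | .false | refl = count-except uniq u∈xs pu qu (p≡q ∘ there)

-- Orbits and cycle minima

Reaches : (ℕ → ℕ) → ℕ → ℕ → Set
Reaches σ x y = ∃ λ k → iter σ k x ≡ y

OrbitMin : (ℕ → ℕ) → ℕ → Set
OrbitMin σ x = ∀ k → x ≤ iter σ k x

iter-+ : ∀ σ m k x → iter σ (m + k) x ≡ iter σ m (iter σ k x)
iter-+ σ zero    k x = refl
iter-+ σ (suc m) k x = cong σ (iter-+ σ m k x)

iter-sucʳ : ∀ σ k x → iter σ (suc k) x ≡ iter σ k (σ x)
iter-sucʳ σ zero    x = refl
iter-sucʳ σ (suc k) x = cong σ (iter-sucʳ σ k x)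

iter-preserves : ∀ (P : ℕ → Set) σ → (∀ {y} → P y → P (σ y)) → ∀ k {x} → P x → P (iter σ k x)
iter-preserves P σ pres zero    px = px
iter-preserves P σ pres (suc k) px = pres (iter-preserves P σ pres k px)

iter-fixed : ∀ σ {x} → σ x ≡ x → ∀ k → iter σ k x ≡ x
iter-fixed σ σx≡x zero    = refl
iter-fixed σ σx≡x (suc k) = trans (cong σ (iter-fixed σ σx≡x k)) σx≡x

iter-agree : ∀ σ τ {x} → (∀ k → τ (iter σ k x) ≡ σ (iter σ k x)) → ∀ k → iter τ k x ≡ iter σ k x
iter-agree σ τ agree zero    = refl
iter-agree σ τ agree (suc k) = trans (cong τ (iter-agree σ τ agree k)) (agree k)

reaches-trans : ∀ {σ x y w} → Reaches σ x y → Reaches σ y w → Reaches σ x w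
reaches-trans {σ} {x} (k , refl) (l , refl) = l + k , iter-+ σ l k x

orbitMin-cong : ∀ {σ τ x} → (∀ k → iter τ k x ≡ iter σ k x) → OrbitMin σ x ⇔ OrbitMin τ x
orbitMin-cong {x = x} τ≗σ =
  mk⇔ (λ min k → subst (x ≤_) (sym (τ≗σ k)) (min k)) (λ min k → subst (x ≤_) (τ≗σ k) (min k))

orbitMin⇒isCycleMin : ∀ {σ x} m → OrbitMin σ x → isCycleMin σ m x ≡ true
orbitMin⇒isCycleMin {σ} {x} m min =
  Equivalence.to T-≡ (all⁻ (λ k → x ≤ᵇ iter σ k x) {xs = upTo m} (All.tabulate (λ {k} _ → ≤⇒≤ᵇ (min k))))

MapsTo : (ℕ → ℕ) → List ℕ → Set
MapsTo σ X = ∀ {y} → y ∈ X → σ y ∈ X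

InjectiveOn : (ℕ → ℕ) → List ℕ → Set
InjectiveOn σ X = ∀ {y y′} → y ∈ X → y′ ∈ X → σ y ≡ σ y′ → y ≡ y′

injectiveOn-⊆ : ∀ {σ X Y} → InjectiveOn σ X → (∀ {y} → y ∈ Y → y ∈ X) → InjectiveOn σ Y
injectiveOn-⊆ σ-inj Y⊆X y∈Y y′∈Y = σ-inj (Y⊆X y∈Y) (Y⊆X y′∈Y)

module Orbit {X : List ℕ} {σ : ℕ → ℕ} (σ-maps : MapsTo σ X) (σ-inj : InjectiveOn σ X) where

  iter-∈ : ∀ k {x} → x ∈ X → iter σ k x ∈ X
  iter-∈ = iter-preserves (_∈ X) σ σ-maps

  private
    shift-cancel : ∀ i d {x} → x ∈ X → iter σ i x ≡ iter σ (i + d) x → x ≡ iter σ d x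
    shift-cancel zero    d x∈X eq = eq
    shift-cancel (suc i) d x∈X eq = shift-cancel i d x∈X (σ-inj (iter-∈ i x∈X) (iter-∈ (i + d) x∈X) eq)

    -- two of the |X| + 1 iterates σ⁰ x, …, σ^|X| x coincide
    period : ∀ {x} → x ∈ X → ∃ λ P → 0 < P × P ≤ length X × iter σ P x ≡ x
    period {x} x∈X with pigeonhole (n<1+n (length X)) (λ i → index (iter-∈ (toℕ i) x∈X))
    ... | i , j , i<j , same = toℕ j ∸ toℕ i , m<n⇒0<n∸m i<j ,
      ≤-trans (m∸n≤m (toℕ j) (toℕ i)) (s≤s⁻¹ (toℕ<n j)) , sym (shift-cancel (toℕ i) _ x∈X iᵗʰ≡jᵗʰ)
      where
      iᵗʰ≡jᵗʰ : iter σ (toℕ i) x ≡ iter σ (toℕ i + (toℕ j ∸ toℕ i)) x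
      iᵗʰ≡jᵗʰ = begin
        iter σ (toℕ i) x                     ≡⟨ lookup-index (iter-∈ (toℕ i) x∈X) ⟩
        lookup X _                           ≡⟨ cong (lookup X) same ⟩
        lookup X _                           ≡⟨ lookup-index (iter-∈ (toℕ j) x∈X) ⟨
        iter σ (toℕ j) x                     ≡⟨ cong (λ k → iter σ k x) (m+[n∸m]≡n (<⇒≤ i<j)) ⟨
        iter σ (toℕ i + (toℕ j ∸ toℕ i)) x ∎
        where open ≡-Reasoning

    iter-multiple : ∀ {P x} → iter σ P x ≡ x → ∀ q → iter σ (q * P) x ≡ x
    iter-multiple         σᴾx≡x zero    = refl
    iter-multiple {P} {x} σᴾx≡x (suc q) =
      trans (iter-+ σ P (q * P) x) (trans (cong (iter σ P) (iter-multiple σᴾx≡x q)) σᴾx≡x)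

  iter-below : ∀ {x} → x ∈ X → ∀ k → ∃ λ j → j < length X × iter σ k x ≡ iter σ j x
  iter-below {x} x∈X k with period x∈X
  ... | P@(suc _) , _ , P≤m , σᴾx≡x = k % P , <-≤-trans (m%n<n k P) P≤m , (begin
    iter σ k x                           ≡⟨ cong (λ i → iter σ i x) (m≡m%n+[m/n]*n k P) ⟩
    iter σ (k % P + (k / P) * P) x       ≡⟨ iter-+ σ (k % P) _ x ⟩
    iter σ (k % P) (iter σ (k / P * P) x) ≡⟨ cong (iter σ (k % P)) (iter-multiple σᴾx≡x (k / P)) ⟩
    iter σ (k % P) x                     ∎)
    where open ≡-Reasoning

  reaches-sym : ∀ {x y} → x ∈ X → Reaches σ x y → Reaches σ y x
  reaches-sym {x} x∈X (k , refl) with period x∈X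
  ... | suc P , _ , _ , σᴾx≡x = k * P , (begin
    iter σ (k * P) (iter σ k x) ≡⟨ iter-+ σ (k * P) k x ⟨
    iter σ (k * P + k) x        ≡⟨ cong (λ i → iter σ i x) (trans (+-comm (k * P) k) (sym (*-suc k P))) ⟩
    iter σ (k * suc P) x        ≡⟨ iter-multiple σᴾx≡x k ⟩
    x                           ∎)
    where open ≡-Reasoning

  cycleMin⇔orbitMin : ∀ {x} → x ∈ X → isCycleMin σ (length X) x ≡ true ⇔ OrbitMin σ x
  cycleMin⇔orbitMin {x} x∈X = mk⇔ below⇒all (orbitMin⇒isCycleMin (length X))
    where
    below⇒all : isCycleMin σ (length X) x ≡ true → OrbitMin σ x
    below⇒all isMin k with iter-below x∈X k
    ... | j , j<m , σᵏx≡σʲx = subst (x ≤_) (sym σᵏx≡σʲx)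
      (≤ᵇ⇒≤ x _ (All.lookup (all⁺ _ (upTo (length X)) (Equivalence.from T-≡ isMin)) (∈-upTo⁺ j<m)))

  reaches? : ∀ {x} → x ∈ X → ∀ y → Dec (Reaches σ x y)
  reaches? {x} x∈X y with anyUpTo? (λ k → iter σ k x ≟ y) (length X)
  ... | yes (k , _ , σᵏx≡y) = yes (k , σᵏx≡y)
  ... | no none = no λ (k , σᵏx≡y) →
    let j , j<m , σᵏx≡σʲx = iter-below x∈X k in none (j , j<m , trans (sym σᵏx≡σʲx) σᵏx≡y)

  orbitMin-unique : ∀ {x y} → x ∈ X → OrbitMin σ x → OrbitMin σ y → Reaches σ x y → x ≡ y
  orbitMin-unique x∈X min-x min-y (k , σᵏx≡y) with reaches-sym x∈X (k , σᵏx≡y)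
  ... | l , σˡy≡x = ≤-antisym (subst (_ ≤_) σᵏx≡y (min-x k)) (subst (_ ≤_) σˡy≡x (min-y l))

  orbit-has-min : ∀ {c} → c ∈ X → ∃ λ u → Reaches σ c u × OrbitMin σ u
  orbit-has-min {c} c∈X = iter σ j₀ c , (j₀ , refl) , u-min
    where
    f : ℕ → ℕ
    f j = iter σ j c
    j₀ : ℕ
    j₀ = argmin f 0 (upTo (length X))
    u-min : OrbitMin σ (f j₀)
    u-min k with iter-below c∈X (k + j₀)
    ... | j , j<m , eq = subst (f j₀ ≤_) (trans (sym eq) (iter-+ σ k j₀ c))
      (All.lookup (f[argmin]≤f[xs] 0 (upTo (length X))) (∈-upTo⁺ j<m))

  isCycleMin-agree : ∀ {τ x} (cm : ℕ → Bool) → (cm x ≡ true ⇔ OrbitMin τ x) → x ∈ X →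
    (∀ k → τ (iter σ k x) ≡ σ (iter σ k x)) → isCycleMin σ (length X) x ≡ cm x
  isCycleMin-agree {τ} cm cm⇔min x∈X agree =
    ⇔→≡ (⇔-trans (cycleMin⇔orbitMin x∈X) (⇔-trans (orbitMin-cong (iter-agree σ τ agree)) (⇔-sym cm⇔min)))

  -- cm is a cycle-minimum test for τ, which may act on a larger set than X.
  module _ {τ : ℕ → ℕ} (cm : ℕ → Bool) (cm⇔min : ∀ {x} → x ∈ X → cm x ≡ true ⇔ OrbitMin τ x) where

    count-isCycleMin-fixed : ∀ {a} → a ∈ X → σ a ≡ a → OrbitMin τ a →
      (∀ {y} → y ∈ X → y ≢ a → τ y ≡ σ y) → count (isCycleMin σ (length X)) X ≡ count cm X
    count-isCycleMin-fixed {a} a∈X σa≡a min-a agree = count-cong X same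
      where
      same : ∀ {x} → x ∈ X → isCycleMin σ (length X) x ≡ cm x
      same {x} x∈X with x ≟ a
      ... | yes refl = trans
        (orbitMin⇒isCycleMin (length X) (λ k → ≤-reflexive (sym (iter-fixed σ σa≡a k))))
        (sym (Equivalence.from (cm⇔min a∈X) min-a))
      ... | no x≢a = isCycleMin-agree cm (cm⇔min x∈X) x∈X
        (λ k → agree (iter-∈ k x∈X) (λ σᵏx≡a → x≢a (a-reaches-only-a (reaches-sym x∈X (k , σᵏx≡a)))))
        where
        a-reaches-only-a : Reaches σ a x → x ≡ a
        a-reaches-only-a (l , σˡa≡x) = trans (sym σˡa≡x) (iter-fixed σ σa≡a l)

    -- τ opens the σ-cycle through c into a path leaving X below all of it, so
    -- exactly the minimum of that cycle stops being a cycle minimum.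
    count-isCycleMin-redirect : ∀ {c w} → Unique X → c ∈ X → (∀ {x} → x ∈ X → w < x) → τ c ≡ w →
      (∀ {y} → y ∈ X → y ≢ c → τ y ≡ σ y) → count (isCycleMin σ (length X)) X ≡ suc (count cm X)
    count-isCycleMin-redirect {c} {w} uniq c∈X w<X τc≡w agree with orbit-has-min c∈X
    ... | u , c⇝u , min-u = count-except uniq u∈X
      (orbitMin⇒isCycleMin (length X) min-u)
      (¬-not (not-τ-min u∈X (reaches-sym c∈X c⇝u) ∘ Equivalence.to (cm⇔min u∈X)))
      same
      where
      u∈X : u ∈ X
      u∈X = subst (_∈ X) (proj₂ c⇝u) (iter-∈ (proj₁ c⇝u) c∈X)

      reaches-w : ∀ k {x} → x ∈ X → iter σ k x ≡ c → Reaches τ x w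
      reaches-w zero    _ refl = 1 , τc≡w
      reaches-w (suc k) {x} x∈X σᵏ⁺¹x≡c with x ≟ c
      ... | yes refl = 1 , τc≡w
      ... | no x≢c with reaches-w k (σ-maps x∈X) (trans (sym (iter-sucʳ σ k x)) σᵏ⁺¹x≡c)
      ...   | l , τˡσx≡w =
        suc l , trans (iter-sucʳ τ l x) (trans (cong (iter τ l) (agree x∈X x≢c)) τˡσx≡w)

      not-τ-min : ∀ {x} → x ∈ X → Reaches σ x c → ¬ OrbitMin τ x
      not-τ-min x∈X (k , σᵏx≡c) min with reaches-w k x∈X σᵏx≡c
      ... | l , τˡx≡w = <⇒≱ (w<X x∈X) (subst (_ ≤_) τˡx≡w (min l))

      same : ∀ {x} → x ∈ X → x ≢ u → isCycleMin σ (length X) x ≡ cm x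
      same {x} x∈X x≢u with reaches? x∈X c
      ... | yes x⇝c = trans
        (¬-not (x≢u ∘ (λ min-x → orbitMin-unique x∈X min-x min-u (reaches-trans x⇝c c⇝u))
                    ∘ Equivalence.to (cycleMin⇔orbitMin x∈X)))
        (sym (¬-not (not-τ-min x∈X x⇝c ∘ Equivalence.to (cm⇔min x∈X))))
      ... | no ¬x⇝c = isCycleMin-agree cm (cm⇔min x∈X) x∈X
        (λ k → agree (iter-∈ k x∈X) (λ σᵏx≡c → ¬x⇝c (k , σᵏx≡c)))

isCycleMin-⊆ : ∀ {σ X Y} → MapsTo σ X → InjectiveOn σ X → MapsTo σ Y → (∀ {y} → y ∈ Y → y ∈ X) →
  ∀ {y} → y ∈ Y → isCycleMin σ (length X) y ≡ isCycleMin σ (length Y) y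
isCycleMin-⊆ σ-maps-X σ-inj σ-maps-Y Y⊆X y∈Y = ⇔→≡ (⇔-trans
  (Orbit.cycleMin⇔orbitMin σ-maps-X σ-inj (Y⊆X y∈Y))
  (⇔-sym (Orbit.cycleMin⇔orbitMin σ-maps-Y (injectiveOn-⊆ σ-inj Y⊆X) y∈Y)))

-- The cyclic successor ζ

minList-∈ : ∀ d y ys → minList d (y ∷ ys) ∈ y ∷ ys
minList-∈ d y ys with foldr-selective ⊓-sel y ys
... | inj₁ min≡y  = here min≡y
... | inj₂ min∈ys = there min∈ys

minList-≤ : ∀ d {y ys w} → w ∈ y ∷ ys → minList d (y ∷ ys) ≤ w
minList-≤ d {y} {ys} {w} w∈y∷ys = foldr-preservesᵒ {P = _≤ w} ⊓-≤ y ys (from-∈ w∈y∷ys)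
  where
  ⊓-≤ : ∀ m n → m ≤ w ⊎ n ≤ w → m ⊓ n ≤ w
  ⊓-≤ m n (inj₁ m≤w) = ≤-trans (m⊓n≤m m n) m≤w
  ⊓-≤ m n (inj₂ n≤w) = ≤-trans (m⊓n≤n m n) n≤w
  from-∈ : w ∈ y ∷ ys → y ≤ w ⊎ Any (_≤ w) ys
  from-∈ (here w≡y)   = inj₁ (≤-reflexive (sym w≡y))
  from-∈ (there w∈ys) = inj₂ (Any.map (≤-reflexive ∘ sym) w∈ys)

ζ-cases : ∀ X {x} → x ∈ X →
  (x < ζ X x × ζ X x ∈ X × (∀ {w} → w ∈ X → x < w → ζ X x ≤ w)) ⊎
  ((∀ {w} → w ∈ X → w ≤ x) × ζ X x ∈ X × (∀ {w} → w ∈ X → ζ X x ≤ w))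
ζ-cases X@(y ∷ ys) {x} _ with filter (λ y → x <? y) X in above-x
... | [] = inj₂ (below , minList-∈ x y ys , minList-≤ x)
  where
  below : ∀ {w} → w ∈ X → w ≤ x
  below w∈X = ≮⇒≥ (λ x<w → case subst (_ ∈_) above-x (∈-filter⁺ (λ y → x <? y) w∈X x<w) of λ ())
... | v ∷ vs = inj₁ (proj₂ next∈ , proj₁ next∈ ,
                     λ w∈X x<w → minList-≤ v (subst (_ ∈_) above-x (∈-filter⁺ (λ y → x <? y) w∈X x<w)))
  where
  next∈ : minList v (v ∷ vs) ∈ X × x < minList v (v ∷ vs)
  next∈ = ∈-filter⁻ (λ y → x <? y) (subst (_ ∈_) (sym above-x) (minList-∈ v v vs))

ζ-∈ : ∀ {X} → MapsTo (ζ X) X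
ζ-∈ {X} x∈X with ζ-cases X x∈X
... | inj₁ (_ , ζx∈X , _) = ζx∈X
... | inj₂ (_ , ζx∈X , _) = ζx∈X

ζ-injective : ∀ {X} → InjectiveOn (ζ X) X
ζ-injective {X} {x} {y} x∈X y∈X ζx≡ζy with ζ-cases X x∈X | ζ-cases X y∈X
... | inj₁ (x<ζx , _ , ζx≤) | inj₁ (y<ζy , _ , ζy≤) with <-cmp x y
...   | tri< x<y _ _ = contradiction ζx≡ζy (<⇒≢ (≤-<-trans (ζx≤ y∈X x<y) y<ζy))
...   | tri≈ _ x≡y _ = x≡y
...   | tri> _ _ y<x = contradiction (sym ζx≡ζy) (<⇒≢ (≤-<-trans (ζy≤ x∈X y<x) x<ζx))
ζ-injective {X} {x} {y} x∈X y∈X ζx≡ζy | inj₁ (x<ζx , _ , _) | inj₂ (_ , _ , ζy≤) =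
  contradiction (sym ζx≡ζy) (<⇒≢ (≤-<-trans (ζy≤ x∈X) x<ζx))
ζ-injective {X} {x} {y} x∈X y∈X ζx≡ζy | inj₂ (_ , _ , ζx≤) | inj₁ (y<ζy , _ , _) =
  contradiction ζx≡ζy (<⇒≢ (≤-<-trans (ζx≤ y∈X) y<ζy))
ζ-injective {X} {x} {y} x∈X y∈X ζx≡ζy | inj₂ (≤x , _ , _) | inj₂ (≤y , _ , _) =
  ≤-antisym (≤y x∈X) (≤x y∈X)

∘ζ-maps : ∀ {f X} → MapsTo f X → MapsTo (f ∘ ζ X) X
∘ζ-maps f-maps = f-maps ∘ ζ-∈

∘ζ-injective : ∀ {f X} → InjectiveOn f X → InjectiveOn (f ∘ ζ X) X
∘ζ-injective f-inj x∈X y∈X fζx≡fζy = ζ-injective x∈X y∈X (f-inj (ζ-∈ x∈X) (ζ-∈ y∈X) fζx≡fζy)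

ζ-next : ∀ {X x v} → x ∈ X → v ∈ X → x < v → (∀ {w} → w ∈ X → x < w → v ≤ w) → ζ X x ≡ v
ζ-next {X} x∈X v∈X x<v v≤ with ζ-cases X x∈X
... | inj₁ (x<ζx , ζx∈X , ζx≤) = ≤-antisym (ζx≤ v∈X x<v) (v≤ ζx∈X x<ζx)
... | inj₂ (≤x , _ , _) = contradiction (≤x v∈X) (<⇒≱ x<v)

ζ-wrap : ∀ {X x v} → x ∈ X → (∀ {w} → w ∈ X → w ≤ x) → v ∈ X → (∀ {w} → w ∈ X → v ≤ w) → ζ X x ≡ v
ζ-wrap {X} x∈X ≤x v∈X v≤ with ζ-cases X x∈X
... | inj₁ (x<ζx , ζx∈X , _) = contradiction (≤x ζx∈X) (<⇒≱ x<ζx)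
... | inj₂ (_ , ζx∈X , ζx≤) = ≤-antisym (ζx≤ v∈X) (v≤ ζx∈X)

ζ-⊆ : ∀ {X Y y} → (∀ {w} → w ∈ Y → w ∈ X) → y ∈ Y → ζ X y ∈ Y → ζ Y y ≡ ζ X y
ζ-⊆ {X} Y⊆X y∈Y ζy∈Y with ζ-cases X (Y⊆X y∈Y)
... | inj₁ (y<ζy , _ , ζy≤) = ζ-next y∈Y ζy∈Y y<ζy (ζy≤ ∘ Y⊆X)
... | inj₂ (≤y , _ , ζy≤) = ζ-wrap y∈Y (≤y ∘ Y⊆X) ζy∈Y (ζy≤ ∘ Y⊆X)

-- Intervals, complements and permutations of {1, …, n}

∈-openInterval⁺ : ∀ {lo hi y} → lo < y → y < hi → y ∈ openInterval lo hi
∈-openInterval⁺ {lo} {hi} {y} lo<y y<hi =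
  subst (_∈ openInterval lo hi) (m+[n∸m]≡n lo+1≤y) (∈-map⁺ (λ i → lo + 1 + i) (∈-upTo⁺ offset<length))
  where
  lo+1≤y : lo + 1 ≤ y
  lo+1≤y = subst (_≤ y) (+-comm 1 lo) lo<y
  offset<length : y ∸ (lo + 1) < hi ∸ lo ∸ 1
  offset<length = subst (y ∸ (lo + 1) <_) (sym (∸-+-assoc hi lo 1)) (∸-monoˡ-< y<hi lo+1≤y)

∈-openInterval⁻ : ∀ {lo hi y} → y ∈ openInterval lo hi → lo < y × y < hi
∈-openInterval⁻ {lo} {hi} y∈ with ∈-map⁻ (λ i → lo + 1 + i) y∈
... | i , i∈ , refl = ≤-trans (≤-reflexive (+-comm 1 lo)) (m≤m+n (lo + 1) i) , (begin-strict
  lo + 1 + i       ≡⟨ +-comm (lo + 1) i ⟩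
  i + (lo + 1)     <⟨ m≤o∸n⇒m+n≤o (suc i) lo+1≤hi i<hi∸[lo+1] ⟩
  hi               ∎)
  where
  open ≤-Reasoning
  i<hi∸[lo+1] : i < hi ∸ (lo + 1)
  i<hi∸[lo+1] = subst (i <_) (∸-+-assoc hi lo 1) (∈-upTo⁻ i∈)
  lo+1≤hi : lo + 1 ≤ hi
  lo+1≤hi = <⇒≤ (m∸n≢0⇒n<m (<⇒≢ (≤-<-trans z≤n i<hi∸[lo+1]) ∘ sym))

openInterval-unique : ∀ lo hi → Unique (openInterval lo hi)
openInterval-unique lo hi = Unique.map⁺ (+-cancelˡ-≡ (lo + 1) _ _) (Unique.upTo⁺ _)

private
  applyUpTo-++ : ∀ (f : ℕ → ℕ) m n → applyUpTo f (m + n) ≡ applyUpTo f m ++ applyUpTo (λ i → f (m + i)) n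
  applyUpTo-++ f zero    n = refl
  applyUpTo-++ f (suc m) n = cong (f 0 ∷_) (applyUpTo-++ (f ∘ suc) m n)

  applyUpTo-cong : ∀ {f g : ℕ → ℕ} → (∀ i → f i ≡ g i) → ∀ n → applyUpTo f n ≡ applyUpTo g n
  applyUpTo-cong f≗g zero    = refl
  applyUpTo-cong f≗g (suc n) = cong₂ _∷_ (f≗g 0) (applyUpTo-cong (f≗g ∘ suc) n)

  openInterval-applyUpTo : ∀ lo k → openInterval lo (suc (lo + k)) ≡ applyUpTo (λ i → lo + 1 + i) k
  openInterval-applyUpTo lo k = trans
    (cong (map (λ i → lo + 1 + i) ∘ upTo) (trans (cong (λ m → m ∸ lo ∸ 1) (sym (+-suc lo k)))
                                                   (cong (_∸ 1) (m+n∸m≡n lo (suc k)))))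
    (map-upTo _ k)

openInterval-++ : ∀ {lo mid hi} → lo ≤ mid → mid < hi →
  openInterval lo (suc mid) ++ openInterval mid hi ≡ openInterval lo hi
openInterval-++ {lo} lo≤mid mid<hi
  with p , refl ← m≤n⇒∃[o]m+o≡n lo≤mid
  with q , refl ← m≤n⇒∃[o]m+o≡n mid<hi = begin
  openInterval lo (suc (lo + p)) ++ openInterval (lo + p) (suc (lo + p + q))
    ≡⟨ cong₂ _++_ (openInterval-applyUpTo lo p) (openInterval-applyUpTo (lo + p) q) ⟩
  applyUpTo (λ i → lo + 1 + i) p ++ applyUpTo (λ i → lo + p + 1 + i) q
    ≡⟨ cong (applyUpTo _ p ++_) (applyUpTo-cong (shift lo p) q) ⟩
  applyUpTo (λ i → lo + 1 + i) p ++ applyUpTo (λ i → lo + 1 + (p + i)) q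
    ≡⟨ applyUpTo-++ (λ i → lo + 1 + i) p q ⟨
  applyUpTo (λ i → lo + 1 + i) (p + q)
    ≡⟨ openInterval-applyUpTo lo (p + q) ⟨
  openInterval lo (suc (lo + (p + q)))
    ≡⟨ cong (λ m → openInterval lo (suc m)) (+-assoc lo p q) ⟨
  openInterval lo (suc (lo + p + q)) ∎
  where
  open ≡-Reasoning
  shift : ∀ lo p i → lo + p + 1 + i ≡ lo + 1 + (p + i)
  shift = solve-∀

ζ-openInterval-suc : ∀ {lo hi y} → y ∈ openInterval lo hi → suc y < hi →
  ζ (openInterval lo hi) y ≡ suc y
ζ-openInterval-suc y∈ sy<hi =
  ζ-next y∈ (∈-openInterval⁺ (m<n⇒m<1+n (proj₁ (∈-openInterval⁻ y∈))) sy<hi) ≤-refl (λ _ y<w → y<w)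

ζ-openInterval-last : ∀ {lo hi y} → y ∈ openInterval lo hi → suc y ≡ hi →
  ζ (openInterval lo hi) y ≡ suc lo
ζ-openInterval-last {lo} y∈ sy≡hi with ∈-openInterval⁻ y∈
... | lo<y , y<hi = ζ-wrap y∈
  (λ w∈ → s≤s⁻¹ (subst (_ <_) (sym sy≡hi) (proj₂ (∈-openInterval⁻ w∈))))
  (∈-openInterval⁺ ≤-refl (≤-<-trans lo<y y<hi))
  (proj₁ ∘ ∈-openInterval⁻)

private
  ∈-any-≟ : ∀ {x} Y → T (any (λ y → ⌊ x ≟ y ⌋) Y) ⇔ x ∈ Y
  ∈-any-≟ Y = mk⇔ (Any.map toWitness ∘ any⁻ _ Y) (any⁺ _ ∘ Any.map fromWitness)

  kept⇔∉ : ∀ {x} Y → not (any (λ y → ⌊ x ≟ y ⌋) Y) ≡ true ⇔ x ∉ Y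
  kept⇔∉ {x} Y with any (λ y → ⌊ x ≟ y ⌋) Y in found
  ... | true  = mk⇔ (λ ()) (contradiction (Equivalence.to (∈-any-≟ Y) (subst T (sym found) _)))
  ... | false = mk⇔ (λ _ x∈Y → subst T found (Equivalence.from (∈-any-≟ Y) x∈Y)) (λ _ → refl)

∈-∖⁺ : ∀ {X Y x} → x ∈ X → x ∉ Y → x ∈ X ∖ Y
∈-∖⁺ {Y = Y} x∈X x∉Y = ∈-filter⁺ (λ x → not (any (λ y → ⌊ x ≟ y ⌋) Y) Bool.≟ true) x∈X
  (Equivalence.from (kept⇔∉ Y) x∉Y)

∈-∖⁻ : ∀ {X Y x} → x ∈ X ∖ Y → x ∈ X × x ∉ Y
∈-∖⁻ {Y = Y} x∈ with ∈-filter⁻ (λ x → not (any (λ y → ⌊ x ≟ y ⌋) Y) Bool.≟ true) x∈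
... | x∈X , kept = x∈X , Equivalence.to (kept⇔∉ Y) kept

∖-disjoint : ∀ {X Y} → (∀ {x} → x ∈ X → x ∉ Y) → X ∖ Y ≡ X
∖-disjoint {Y = Y} X∩Y≡∅ = filter-all _ (All.tabulate (Equivalence.from (kept⇔∉ Y) ∘ X∩Y≡∅))

∖-self : ∀ X → X ∖ X ≡ []
∖-self X = filter-none _ (All.tabulate (λ x∈X kept → Equivalence.to (kept⇔∉ X) kept x∈X))

∖-unionOfCycles : ∀ {σ τ X Y} → MapsTo σ X → MapsTo τ X →
  (∀ {y} → y ∈ X → τ (σ y) ≡ y) → (∀ {y} → y ∈ X → σ (τ y) ≡ y) →
  UnionOfCycles σ τ Y → UnionOfCycles σ τ (X ∖ Y)
∖-unionOfCycles {σ} {τ} σ-maps τ-maps τσ≡id στ≡id Y-cycles x x∈ with ∈-∖⁻ x∈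
... | x∈X , x∉Y =
  ∈-∖⁺ (σ-maps x∈X) (λ σx∈Y → x∉Y (subst (_∈ _) (τσ≡id x∈X) (proj₂ (Y-cycles (σ x) σx∈Y)))) ,
  ∈-∖⁺ (τ-maps x∈X) (λ τx∈Y → x∉Y (subst (_∈ _) (στ≡id x∈X) (proj₁ (Y-cycles (τ x) τx∈Y))))

range1⁻ : ∀ {n y} → y ∈ range1 n → ∃ λ k → k < n × y ≡ suc k
range1⁻ y∈ with ∈-map⁻ suc y∈
... | k , k∈ , y≡1+k = k , ∈-upTo⁻ k∈ , y≡1+k

private
  liftFin-suc : ∀ {n} (f : Fin n → Fin n) {k} (k<n : k < n) →
    liftFin f (suc k) ≡ suc (toℕ (f (fromℕ< k<n)))
  liftFin-suc {n} f {k} k<n with k <? n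
  ... | yes _    = refl
  ... | no  k≮n = contradiction k<n k≮n

liftFin-∈ : ∀ {n} (f : Fin n → Fin n) → MapsTo (liftFin f) (range1 n)
liftFin-∈ f y∈ with range1⁻ y∈
... | k , k<n , refl = subst (_∈ _) (sym (liftFin-suc f k<n)) (∈-map⁺ suc (∈-upTo⁺ (toℕ<n _)))

liftFin-inverse : ∀ {n} (f g : Fin n → Fin n) → (∀ {i} → f (g i) ≡ i) →
  ∀ {y} → y ∈ range1 n → liftFin f (liftFin g y) ≡ y
liftFin-inverse f g fg≡id y∈ with range1⁻ y∈
... | k , k<n , refl = begin
  liftFin f (liftFin g (suc k))            ≡⟨ cong (liftFin f) (liftFin-suc g k<n) ⟩
  liftFin f (suc (toℕ (g (fromℕ< k<n))))   ≡⟨ liftFin-suc f (toℕ<n _) ⟩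
  suc (toℕ (f (fromℕ< (toℕ<n _))))         ≡⟨ cong (suc ∘ toℕ ∘ f) (fromℕ<-toℕ _ (toℕ<n _)) ⟩
  suc (toℕ (f (g (fromℕ< k<n))))           ≡⟨ cong (suc ∘ toℕ) fg≡id ⟩
  suc (toℕ (fromℕ< k<n))                   ≡⟨ cong suc (toℕ-fromℕ< k<n) ⟩
  suc k                                    ∎
  where open ≡-Reasoning

-- Additivity of the genus

module _ where
  open import Data.Integer using (ℤ; +_; _-_)
  import Data.Integer as ℤ
  open import Data.Integer.Properties using (pos-+)
  open import Data.Integer.Tactic.RingSolver using () renaming (solve-∀ to ℤ-solve-∀)

  private
    numerator-split : ∀ (m₁ m₂ z₁ z₂ z′₁ z′₂ : ℤ) →
      ((m₁ ℤ.+ m₂ ℤ.+ + 1) - (z₁ ℤ.+ z₂) - (z′₁ ℤ.+ z′₂ - + 1)) ℤ.* + 4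
        ≡ (((m₁ ℤ.+ + 1) - z₁ - z′₁) ℤ.* + 2 ℤ.+ ((m₂ ℤ.+ + 1) - z₂ - z′₂) ℤ.* + 2) ℤ.* + 2
    numerator-split = ℤ-solve-∀

    excess-split : ∀ m m₁ m₂ z z₁ z₂ z′ z′₁ z′₂ → m ≡ m₁ + m₂ → z ≡ z₁ + z₂ → suc z′ ≡ z′₁ + z′₂ →
      ((+ (m + 1) - + z) - + z′) ℚ./ 2
        ≃ ((((+ (m₁ + 1) - + z₁) - + z′₁) ℚ./ 2) +q (((+ (m₂ + 1) - + z₂) - + z′₂) ℚ./ 2))
    excess-split _ m₁ m₂ _ z₁ z₂ z′ z′₁ z′₂ refl refl 1+z′≡ = *≡* (begin
      ((+ (m₁ + m₂ + 1) - + (z₁ + z₂)) - + z′) ℤ.* + 4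
        ≡⟨ cong₂ (λ M Z → ((M - Z) - + z′) ℤ.* + 4)
             (trans (pos-+ (m₁ + m₂) 1) (cong (ℤ._+ + 1) (pos-+ m₁ m₂))) (pos-+ z₁ z₂) ⟩
      ((+ m₁ ℤ.+ + m₂ ℤ.+ + 1) - (+ z₁ ℤ.+ + z₂) - + z′) ℤ.* + 4
        ≡⟨ cong (λ Z′ → ((+ m₁ ℤ.+ + m₂ ℤ.+ + 1) - (+ z₁ ℤ.+ + z₂) - Z′) ℤ.* + 4) z′≡ ⟩
      ((+ m₁ ℤ.+ + m₂ ℤ.+ + 1) - (+ z₁ ℤ.+ + z₂) - (+ z′₁ ℤ.+ + z′₂ - + 1)) ℤ.* + 4
        ≡⟨ numerator-split (+ m₁) (+ m₂) (+ z₁) (+ z₂) (+ z′₁) (+ z′₂) ⟩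
      (((+ m₁ ℤ.+ + 1) - + z₁ - + z′₁) ℤ.* + 2 ℤ.+ ((+ m₂ ℤ.+ + 1) - + z₂ - + z′₂) ℤ.* + 2) ℤ.* + 2
        ≡⟨ cong₂ (λ M₁ M₂ → ((M₁ - + z₁ - + z′₁) ℤ.* + 2 ℤ.+ (M₂ - + z₂ - + z′₂) ℤ.* + 2) ℤ.* + 2)
             (sym (pos-+ m₁ 1)) (sym (pos-+ m₂ 1)) ⟩
      (((+ (m₁ + 1)) - + z₁ - + z′₁) ℤ.* + 2 ℤ.+ ((+ (m₂ + 1)) - + z₂ - + z′₂) ℤ.* + 2) ℤ.* + 2 ∎)
      where
      open ≡-Reasoning
      z′≡ : + z′ ≡ + z′₁ ℤ.+ + z′₂ - + 1
      z′≡ = trans (cong (λ k → + k - + 1) 1+z′≡) (cong (_- + 1) (pos-+ z′₁ z′₂))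

  genus-split : ∀ X X₁ X₂ π πinv →
    length X ≡ length X₁ + length X₂ →
    z X π ≡ z X₁ π + z X₂ π →
    suc (z X (πinv ∘ ζ X)) ≡ z X₁ (πinv ∘ ζ X₁) + z X₂ (πinv ∘ ζ X₂) →
    genus X π πinv ≃ (genus X₁ π πinv +q genus X₂ π πinv)
  genus-split X X₁ X₂ π πinv = excess-split
    (length X) (length X₁) (length X₂) (z X π) (z X₁ π) (z X₂ π)
    (z X (πinv ∘ ζ X)) (z X₁ (πinv ∘ ζ X₁)) (z X₂ (πinv ∘ ζ X₂))

-- Splitting α along X₁

module Splitting (n : ℕ) (α : Permutation′ n) (a : ℕ) (1≤a : 1 ≤ a) (a≤n : a ≤ n)
  (a+1<b : a + 1 < ap α a) (X₁-cycles : UnionOfCycles (ap α) (apInv α) (openInterval a (ap α a))) where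

  σ σ⁻¹ : ℕ → ℕ
  σ   = ap α
  σ⁻¹ = apInv α

  b : ℕ
  b = σ a

  R X₁ X₂ : List ℕ
  R  = range1 n
  X₁ = openInterval a b
  X₂ = R ∖ X₁

  β : List ℕ → ℕ → ℕ
  β X = σ⁻¹ ∘ ζ X

  ∈R⁺ : ∀ {y} → 0 < y → y ≤ n → y ∈ R
  ∈R⁺ 0<y y≤n = ∈-openInterval⁺ {0} {suc n} 0<y (s≤s y≤n)

  ∈R⁻ : ∀ {y} → y ∈ R → 0 < y × y ≤ n
  ∈R⁻ y∈R with ∈-openInterval⁻ {0} {suc n} y∈R
  ... | 0<y , y<1+n = 0<y , s≤s⁻¹ y<1+n

  σ-maps-R : MapsTo σ R
  σ-maps-R = liftFin-∈ _

  σ⁻¹-maps-R : MapsTo σ⁻¹ R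
  σ⁻¹-maps-R = liftFin-∈ _

  σ⁻¹σ≡id : ∀ {y} → y ∈ R → σ⁻¹ (σ y) ≡ y
  σ⁻¹σ≡id = liftFin-inverse _ _ (inverseˡ α)

  σσ⁻¹≡id : ∀ {y} → y ∈ R → σ (σ⁻¹ y) ≡ y
  σσ⁻¹≡id = liftFin-inverse _ _ (inverseʳ α)

  σ-inj-R : InjectiveOn σ R
  σ-inj-R y∈R y′∈R σy≡σy′ = trans (sym (σ⁻¹σ≡id y∈R)) (trans (cong σ⁻¹ σy≡σy′) (σ⁻¹σ≡id y′∈R))

  σ⁻¹-inj-R : InjectiveOn σ⁻¹ R
  σ⁻¹-inj-R y∈R y′∈R σ⁻¹y≡σ⁻¹y′ = trans (sym (σσ⁻¹≡id y∈R)) (trans (cong σ σ⁻¹y≡σ⁻¹y′) (σσ⁻¹≡id y′∈R))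

  a∈R : a ∈ R
  a∈R = ∈R⁺ 1≤a a≤n

  b∈R : b ∈ R
  b∈R = σ-maps-R a∈R

  b≤n : b ≤ n
  b≤n = proj₂ (∈R⁻ b∈R)

  c : ℕ
  c = pred b

  1+c≡b : suc c ≡ b
  1+c≡b = suc-pred b {{>-nonZero (proj₁ (∈R⁻ b∈R))}}

  a<c : a < c
  a<c = s≤s⁻¹ (subst (suc a <_) (sym 1+c≡b) (subst (_< b) (+-comm a 1) a+1<b))

  c<n : c < n
  c<n = subst (_≤ n) (sym 1+c≡b) b≤n

  1+a∈X₁ : suc a ∈ X₁
  1+a∈X₁ = ∈-openInterval⁺ ≤-refl (subst (_< b) (+-comm a 1) a+1<b)

  c∈X₁ : c ∈ X₁
  c∈X₁ = ∈-openInterval⁺ a<c (subst (c <_) 1+c≡b ≤-refl)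

  X₁⊆R : ∀ {y} → y ∈ X₁ → y ∈ R
  X₁⊆R y∈X₁ with ∈-openInterval⁻ y∈X₁
  ... | a<y , y<b = ∈R⁺ (≤-<-trans z≤n a<y) (<⇒≤ (<-≤-trans y<b b≤n))

  X₂⊆R : ∀ {y} → y ∈ X₂ → y ∈ R
  X₂⊆R = proj₁ ∘ ∈-∖⁻ {Y = X₁}

  split : ∀ (f : List ℕ → ℕ) → (∀ xs ys → f (xs ++ ys) ≡ f xs + f ys) → f R ≡ f X₁ + f X₂
  split f f-++ = begin
    f R                        ≡⟨ cong f R≡L++X₁++H ⟩
    f (L ++ X₁ ++ H)           ≡⟨ trans (f-++ L (X₁ ++ H)) (cong (f L +_) (f-++ X₁ H)) ⟩
    f L + (f X₁ + f H)         ≡⟨ exchange (f L) (f X₁) (f H) ⟩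
    f X₁ + (f L + f H)         ≡⟨ cong (f X₁ +_) (trans (sym (f-++ L H)) (cong f (sym X₂≡L++H))) ⟩
    f X₁ + f X₂                ∎
    where
    open ≡-Reasoning
    L H : List ℕ
    L = openInterval 0 (suc a)
    H = openInterval c (suc n)

    exchange : ∀ x y w → x + (y + w) ≡ y + (x + w)
    exchange = solve-∀

    R≡L++X₁++H : R ≡ L ++ X₁ ++ H
    R≡L++X₁++H = begin
      openInterval 0 (suc n)                 ≡⟨ openInterval-++ z≤n (s≤s a≤n) ⟨
      L ++ openInterval a (suc n)      ≡⟨ cong (L ++_) (openInterval-++ (<⇒≤ a<c) (s≤s (<⇒≤ c<n))) ⟨
      L ++ openInterval a (suc c) ++ H       ≡⟨ cong (λ m → L ++ openInterval a m ++ H) 1+c≡b ⟩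
      L ++ X₁ ++ H                           ∎

    X₂≡L++H : X₂ ≡ L ++ H
    X₂≡L++H = begin
      R ∖ X₁                               ≡⟨ cong (_∖ X₁) R≡L++X₁++H ⟩
      (L ++ X₁ ++ H) ∖ X₁                  ≡⟨ filter-++ _ L (X₁ ++ H) ⟩
      L ∖ X₁ ++ (X₁ ++ H) ∖ X₁             ≡⟨ cong (L ∖ X₁ ++_) (filter-++ _ X₁ H) ⟩
      L ∖ X₁ ++ X₁ ∖ X₁ ++ H ∖ X₁          ≡⟨ cong₂ _++_ (∖-disjoint L∩X₁≡∅)
                                                 (cong₂ _++_ (∖-self X₁) (∖-disjoint H∩X₁≡∅)) ⟩
      L ++ H                               ∎
      where
      L∩X₁≡∅ : ∀ {y} → y ∈ L → y ∉ X₁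
      L∩X₁≡∅ y∈L y∈X₁ = <⇒≱ (proj₁ (∈-openInterval⁻ y∈X₁)) (s≤s⁻¹ (proj₂ (∈-openInterval⁻ {0} y∈L)))
      H∩X₁≡∅ : ∀ {y} → y ∈ H → y ∉ X₁
      H∩X₁≡∅ y∈H y∈X₁ = <⇒≱ (proj₂ (∈-openInterval⁻ y∈X₁))
        (subst (_≤ _) 1+c≡b (proj₁ (∈-openInterval⁻ {c} y∈H)))

  X₂-cycles : UnionOfCycles σ σ⁻¹ X₂
  X₂-cycles = ∖-unionOfCycles σ-maps-R σ⁻¹-maps-R σ⁻¹σ≡id σσ⁻¹≡id X₁-cycles

  module Block {X : List ℕ} (X-cycles : UnionOfCycles σ σ⁻¹ X) (X⊆R : ∀ {y} → y ∈ X → y ∈ R) where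

    σ-maps : MapsTo σ X
    σ-maps y∈X = proj₁ (X-cycles _ y∈X)

    β-maps : MapsTo (β X) X
    β-maps = ∘ζ-maps (λ y∈X → proj₂ (X-cycles _ y∈X))

    β-inj : InjectiveOn (β X) X
    β-inj = ∘ζ-injective (injectiveOn-⊆ σ⁻¹-inj-R X⊆R)

    isCycleMin-σ : ∀ {x} → x ∈ X → isCycleMin σ (length R) x ≡ isCycleMin σ (length X) x
    isCycleMin-σ = isCycleMin-⊆ σ-maps-R σ-inj-R σ-maps X⊆R

  module X₁-block = Block X₁-cycles X₁⊆R
  module X₂-block = Block X₂-cycles X₂⊆R

  z-σ : z R σ ≡ z X₁ σ + z X₂ σ
  z-σ = trans (split (count _) (count-++ _))
    (cong₂ _+_ (count-cong X₁ X₁-block.isCycleMin-σ) (count-cong X₂ X₂-block.isCycleMin-σ))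

  ζR-suc : ∀ {y} → y ∈ R → y < n → ζ R y ≡ suc y
  ζR-suc y∈R y<n = ζ-openInterval-suc {0} {suc n} y∈R (s≤s y<n)

  β-maps-R : MapsTo (β R) R
  β-maps-R = ∘ζ-maps σ⁻¹-maps-R

  β-inj-R : InjectiveOn (β R) R
  β-inj-R = ∘ζ-injective σ⁻¹-inj-R

  βc≡a : β R c ≡ a
  βc≡a = trans (cong σ⁻¹ (trans (ζR-suc (X₁⊆R c∈X₁) c<n) 1+c≡b)) (σ⁻¹σ≡id a∈R)

  β-agrees-X₁ : ∀ {y} → y ∈ X₁ → y ≢ c → β R y ≡ β X₁ y
  β-agrees-X₁ {y} y∈X₁ y≢c with ∈-openInterval⁻ y∈X₁
  ... | a<y , y<b = cong σ⁻¹ (sym (ζ-⊆ X₁⊆R y∈X₁ (subst (_∈ X₁) (sym ζRy≡1+y) 1+y∈X₁)))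
    where
    ζRy≡1+y : ζ R y ≡ suc y
    ζRy≡1+y = ζR-suc (X₁⊆R y∈X₁) (<-≤-trans y<b b≤n)
    1+y∈X₁ : suc y ∈ X₁
    1+y∈X₁ = ∈-openInterval⁺ (m<n⇒m<1+n a<y)
      (≤∧≢⇒< y<b (λ 1+y≡b → y≢c (suc-injective (trans 1+y≡b (sym 1+c≡b)))))

  a∈X₂ : a ∈ X₂
  a∈X₂ = ∈-∖⁺ a∈R (λ a∈X₁ → <-irrefl refl (proj₁ (∈-openInterval⁻ a∈X₁)))

  β-agrees-X₂ : ∀ {y} → y ∈ X₂ → y ≢ a → β R y ≡ β X₂ y
  β-agrees-X₂ {y} y∈X₂ y≢a with ∈-∖⁻ {Y = X₁} y∈X₂
  ... | y∈R , y∉X₁ = cong σ⁻¹ (sym (ζ-⊆ X₂⊆R y∈X₂ (∈-∖⁺ (ζ-∈ y∈R) ζRy∉X₁)))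
    where
    ζRy∉X₁ : ζ R y ∉ X₁
    ζRy∉X₁ with m≤n⇒m<n∨m≡n (proj₂ (∈R⁻ y∈R))
    ... | inj₁ y<n = λ ζRy∈X₁ →
      let a<1+y , 1+y<b = ∈-openInterval⁻ (subst (_∈ X₁) (ζR-suc y∈R y<n) ζRy∈X₁)
      in y∉X₁ (∈-openInterval⁺ (≤∧≢⇒< (s≤s⁻¹ a<1+y) (y≢a ∘ sym)) (<-trans (n<1+n y) 1+y<b))
    ... | inj₂ y≡n = λ ζRy∈X₁ → <⇒≱ (proj₁ (∈-openInterval⁻
      (subst (_∈ X₁) (ζ-openInterval-last {0} {suc n} y∈R (cong suc y≡n)) ζRy∈X₁))) 1≤a

  β₂a≡a : β X₂ a ≡ a
  β₂a≡a = trans (cong σ⁻¹ ζX₂a≡b) (σ⁻¹σ≡id a∈R)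
    where
    ζX₂a≡b : ζ X₂ a ≡ b
    ζX₂a≡b = ζ-next {X₂} a∈X₂ (∈-∖⁺ b∈R (λ b∈X₁ → <-irrefl refl (proj₂ (∈-openInterval⁻ {a} b∈X₁))))
      (<-trans a<c (subst (c <_) 1+c≡b ≤-refl))
      (λ w∈X₂ a<w → ≮⇒≥ (λ w<b → proj₂ (∈-∖⁻ {R} {X₁} w∈X₂) (∈-openInterval⁺ a<w w<b)))

  β-preserves-a∪X₁ : ∀ {y} → a ≡ y ⊎ y ∈ X₁ → a ≡ β R y ⊎ β R y ∈ X₁
  β-preserves-a∪X₁ (inj₁ refl) =
    inj₂ (proj₂ (X₁-cycles _ (subst (_∈ X₁) (sym (ζR-suc a∈R (<-trans a<c c<n))) 1+a∈X₁)))
  β-preserves-a∪X₁ {y} (inj₂ y∈X₁) with y ≟ c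
  ... | yes refl = inj₁ (sym βc≡a)
  ... | no  y≢c  = inj₂ (subst (_∈ X₁) (sym (β-agrees-X₁ y∈X₁ y≢c)) (X₁-block.β-maps y∈X₁))

  a-orbitMin : OrbitMin (β R) a
  a-orbitMin k with iter-preserves (λ y → a ≡ y ⊎ y ∈ X₁) (β R) β-preserves-a∪X₁ k (inj₁ refl)
  ... | inj₁ a≡βᵏa   = ≤-reflexive a≡βᵏa
  ... | inj₂ βᵏa∈X₁ = <⇒≤ (proj₁ (∈-openInterval⁻ βᵏa∈X₁))

  z-β : suc (z R (β R)) ≡ z X₁ (β X₁) + z X₂ (β X₂)
  z-β = trans (cong suc (split (count cm) (count-++ cm))) (sym (cong₂ _+_
    (Orbit.count-isCycleMin-redirect X₁-block.β-maps X₁-block.β-inj cm (cm⇔min ∘ X₁⊆R)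
      (openInterval-unique a b) c∈X₁ (proj₁ ∘ ∈-openInterval⁻) βc≡a β-agrees-X₁)
    (Orbit.count-isCycleMin-fixed X₂-block.β-maps X₂-block.β-inj cm (cm⇔min ∘ X₂⊆R)
      a∈X₂ β₂a≡a a-orbitMin β-agrees-X₂)))
    where
    cm : ℕ → Bool
    cm = isCycleMin (β R) (length R)
    cm⇔min : ∀ {x} → x ∈ R → cm x ≡ true ⇔ OrbitMin (β R) x
    cm⇔min = Orbit.cycleMin⇔orbitMin β-maps-R β-inj-R

lemma3p4 : (n : ℕ) (α : Permutation′ n) (a : ℕ) →
    1 ≤ a → a ≤ n → a + 1 < ap α a →
    UnionOfCycles (ap α) (apInv α) (openInterval a (ap α a)) →
    genus (range1 n) (ap α) (apInv α)
    ≃ (genus (openInterval a (ap α a)) (ap α) (apInv α)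
    +q
    genus (range1 n ∖ openInterval a (ap α a)) (ap α) (apInv α))
lemma3p4 n α a 1≤a a≤n a+1<b X₁-cycles =
  genus-split R X₁ X₂ σ σ⁻¹ (split length (λ xs ys → length-++ xs)) z-σ z-β
  where open Splitting n α a 1≤a a≤n a+1<b X₁-cycles
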